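{- The logic $\mathsf{SE}$ is consistent, i.e., $\not\vdash_{\mathsf{SE}}\bot$.
   Context: Syntax of $\mathsf{SE}$. There are countably infinite sets of justification constants $\mathsf{JConst}=\{0,1,c_1,c_2,\dots\}$ and justification variables $\mathsf{JVar}$. Terms: constants, variables, and $s\cdot t$, $s+t$ for terms $s,t$. Formulas: $\bot$, atomic propositions $P\in\mathsf{Prop}$, $A\to B$, and $t:A$; $\neg,\wedge,\vee,\leftrightarrow$ are abbreviations. $A[w/t]$ is simultaneous replacement of the variable $w$ by term $t$. Axioms of $\mathsf{SE}$ (for arbitrary formulas $A,B$ and variables $w,x,y,z$): (CL) propositional tautologies; (j) $x:(A\to B)\to(y:A\to x\cdot y:B)$; (j+) $x:A\wedge y:A\to(x+y):A$; (a+) $A[w/(x+y)+z]\to A[w/x+(y+z)]$; (c+) $A[w/x+y]\to A[w/y+x]$; (0+) $A[w/x+0]\leftrightarrow A[w/x]$; (am) $A[w/(x\cdot y)\cdot z]\leftrightarrow A[w/x\cdot(y\cdot z)]$; (a0) $A[w/x\cdot 0]\leftrightarrow A[w/0]$, $A[w/0\cdot x]\leftrightarrow A[w/0]$; (a1) $A[w/x\cdot 1]\leftrightarrow A[w/x]$, $A[w/1\cdot x]\leftrightarrow A[w/x]$; (dl) $A[w/x\cdot(y+z)]\leftrightarrow A[w/x\cdot y+x\cdot z]$; (dr) $A[w/(y+z)\cdot x]\leftrightarrow A[w/y\cdot x+z\cdot x]$. Rules: modus ponens and (jv): from $A$ infer $A[x/t]$. $\vdash_{\mathsf{SE}}F$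 means $F$ is derivable from the axioms by these rules. -}

module Defs where

open import Data.Nat using (ℕ; _≟_)
open import Data.Bool using (Bool; true; false; not; _∨_)
open import Relation.Nullary using (yes; no)
open import Relation.Binary.PropositionalEquality using (_≡_)

data JConst : Set where
  c0 : JConst
  c1 : JConst
  cN : ℕ → JConst

JVar : Set
JVar = ℕ

PropVar : Set
PropVar = ℕ

infixl 7 _·_
infixl 6 _⊕_
data Term : Set where
  const : JConst → Term
  var   : JVar → Term
  _·_   : Term → Term → Term
  _⊕_   : Term → Term → Term

𝟎 𝟏 : Term
𝟎 = const c0
𝟏 = const c1

infixr 4 _⇒_
infixr 5 _∧'_ _∨'_
infix 3 _⇔_
infix  6 _∶_
data Formula : Set where
  ⊥'  : Formula
  atom : PropVar → Formula
  _⇒_  : Formula → Formula → Formula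
  _∶_  : Term → Formula → Formula

¬' : Formula → Formula
¬' A = A ⇒ ⊥'

_∧'_ : Formula → Formula → Formula
A ∧' B = ¬' (A ⇒ ¬' B)

_∨'_ : Formula → Formula → Formula
A ∨' B = ¬' A ⇒ B

_⇔_ : Formula → Formula → Formula
A ⇔ B = (A ⇒ B) ∧' (B ⇒ A)

substT : JVar → Term → Term → Term
substT w t (const c) = const c
substT w t (var x) with x ≟ w
... | yes _ = t
... | no  _ = var x
substT w t (s · u) = substT w t s · substT w t u
substT w t (s ⊕ u) = substT w t s ⊕ substT w t u

infix 8 _[_/_]
_[_/_] : Formula → JVar → Term → Formula
⊥' [ w / t ] = ⊥'
atom P [ w / t ] = atom P
(A ⇒ B) [ w / t ] = (A [ w / t ]) ⇒ (B [ w / t ])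
(s ∶ A) [ w / t ] = substT w t s ∶ (A [ w / t ])

-- propositional tautologies: atoms and formulas t:A are propositional atoms
evalB : (Formula → Bool) → Formula → Bool
evalB v ⊥' = false
evalB v (atom P) = v (atom P)
evalB v (A ⇒ B) = not (evalB v A) ∨ evalB v B
evalB v (t ∶ A) = v (t ∶ A)

Tautology : Formula → Set
Tautology A = (v : Formula → Bool) → evalB v A ≡ true

infix 1 ⊢SE_
data ⊢SE_ : Formula → Set where
  CL  : ∀ {A} → Tautology A → ⊢SE A
  ax-j  : ∀ (A B : Formula) (x y : JVar) →
          ⊢SE (var x ∶ (A ⇒ B)) ⇒ (var y ∶ A ⇒ (var x · var y) ∶ B)
  ax-j+ : ∀ (A : Formula) (x y : JVar) →
          ⊢SE (var x ∶ A ∧' var y ∶ A) ⇒ (var x ⊕ var y) ∶ A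
  ax-a+ : ∀ (A : Formula) (w x y z : JVar) →
          ⊢SE A [ w / (var x ⊕ var y) ⊕ var z ] ⇒ A [ w / var x ⊕ (var y ⊕ var z) ]
  ax-c+ : ∀ (A : Formula) (w x y : JVar) →
          ⊢SE A [ w / var x ⊕ var y ] ⇒ A [ w / var y ⊕ var x ]
  ax-0+ : ∀ (A : Formula) (w x : JVar) →
          ⊢SE A [ w / var x ⊕ 𝟎 ] ⇔ A [ w / var x ]
  ax-am : ∀ (A : Formula) (w x y z : JVar) →
          ⊢SE A [ w / (var x · var y) · var z ] ⇔ A [ w / var x · (var y · var z) ]
  ax-a0r : ∀ (A : Formula) (w x : JVar) →
          ⊢SE A [ w / var x · 𝟎 ] ⇔ A [ w / 𝟎 ]
  ax-a0l : ∀ (A : Formula) (w x : JVar) →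
          ⊢SE A [ w / 𝟎 · var x ] ⇔ A [ w / 𝟎 ]
  ax-a1r : ∀ (A : Formula) (w x : JVar) →
          ⊢SE A [ w / var x · 𝟏 ] ⇔ A [ w / var x ]
  ax-a1l : ∀ (A : Formula) (w x : JVar) →
          ⊢SE A [ w / 𝟏 · var x ] ⇔ A [ w / var x ]
  ax-dl : ∀ (A : Formula) (w x y z : JVar) →
          ⊢SE A [ w / var x · (var y ⊕ var z) ] ⇔ A [ w / var x · var y ⊕ var x · var z ]
  ax-dr : ∀ (A : Formula) (w x y z : JVar) →
          ⊢SE A [ w / (var y ⊕ var z) · var x ] ⇔ A [ w / var y · var x ⊕ var z · var x ]
  mp : ∀ {A B} → ⊢SE A ⇒ B → ⊢SE A → ⊢SE B
  jv : ∀ {A} (x : JVar) (t : Term) → ⊢SE A → ⊢SE A [ x / t ]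

{-# OPTIONS --safe #-}
module Submission where

open import Defs
open import Data.Bool using (Bool; true; false; not; _∨_)
open import Data.Bool.Properties using (∨-inverseˡ)
open import Relation.Nullary using (¬_)
open import Relation.Binary.PropositionalEquality using (_≡_; refl; sym; trans; cong₂)

-- Read every justification assertion t : A as true. Under this interpretation
-- a formula's truth value does not depend on any term, so the substitution
-- axioms and the rule (jv) become trivial, (j) and (j+) have true conclusions,
-- and modus ponens preserves truth. Hence every theorem of SE is true, while
-- ⊥ is false.

evalB-⇒-of-≡ : ∀ v A B → evalB v A ≡ evalB v B → evalB v (A ⇒ B) ≡ true
evalB-⇒-of-≡ v A B eq rewrite eq = ∨-inverseˡ (evalB v B)

evalB-⇔-of-≡ : ∀ v A B → evalB v A ≡ evalB v B → evalB v (A ⇔ B) ≡ true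
evalB-⇔-of-≡ v A B eq rewrite eq with evalB v B
... | true  = refl
... | false = refl

evalB-mp : ∀ v A B → evalB v (A ⇒ B) ≡ true → evalB v A ≡ true → evalB v B ≡ true
evalB-mp v A B A⇒B-true A-true with evalB v A
evalB-mp v A B A⇒B-true refl | true = A⇒B-true

allJustified : Formula → Bool
allJustified (_ ∶ _) = true
allJustified _       = false

⟦_⟧ : Formula → Bool
⟦_⟧ = evalB allJustified

⟦⟧-subst : ∀ A w t → ⟦ A [ w / t ] ⟧ ≡ ⟦ A ⟧
⟦⟧-subst ⊥'       w t = refl
⟦⟧-subst (atom P) w t = refl
⟦⟧-subst (A ⇒ B)  w t = cong₂ (λ a b → not a ∨ b) (⟦⟧-subst A w t) (⟦⟧-subst B w t)
⟦⟧-subst (s ∶ A)  w t = refl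

⟦⟧-subst-swap : ∀ A w s t → ⟦ A [ w / s ] ⟧ ≡ ⟦ A [ w / t ] ⟧
⟦⟧-subst-swap A w s t = trans (⟦⟧-subst A w s) (sym (⟦⟧-subst A w t))

⟦⟧-subst-⇒ : ∀ A w s t → ⟦ A [ w / s ] ⇒ A [ w / t ] ⟧ ≡ true
⟦⟧-subst-⇒ A w s t =
  evalB-⇒-of-≡ allJustified (A [ w / s ]) (A [ w / t ]) (⟦⟧-subst-swap A w s t)

⟦⟧-subst-⇔ : ∀ A w s t → ⟦ A [ w / s ] ⇔ A [ w / t ] ⟧ ≡ true
⟦⟧-subst-⇔ A w s t =
  evalB-⇔-of-≡ allJustified (A [ w / s ]) (A [ w / t ]) (⟦⟧-subst-swap A w s t)

⟦⟧-sound : ∀ {A} → ⊢SE A → ⟦ A ⟧ ≡ true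
⟦⟧-sound (CL taut)                = taut allJustified
⟦⟧-sound (ax-j _ _ _ _)           = refl
⟦⟧-sound (ax-j+ _ _ _)            = refl
⟦⟧-sound (ax-a+ A w _ _ _)        = ⟦⟧-subst-⇒ A w _ _
⟦⟧-sound (ax-c+ A w _ _)          = ⟦⟧-subst-⇒ A w _ _
⟦⟧-sound (ax-0+ A w _)            = ⟦⟧-subst-⇔ A w _ _
⟦⟧-sound (ax-am A w _ _ _)        = ⟦⟧-subst-⇔ A w _ _
⟦⟧-sound (ax-a0r A w _)           = ⟦⟧-subst-⇔ A w _ _
⟦⟧-sound (ax-a0l A w _)           = ⟦⟧-subst-⇔ A w _ _
⟦⟧-sound (ax-a1r A w _)           = ⟦⟧-subst-⇔ A w _ _
⟦⟧-sound (ax-a1l A w _)           = ⟦⟧-subst-⇔ A w _ _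
⟦⟧-sound (ax-dl A w _ _ _)        = ⟦⟧-subst-⇔ A w _ _
⟦⟧-sound (ax-dr A w _ _ _)        = ⟦⟧-subst-⇔ A w _ _
⟦⟧-sound (mp {A} {B} ⊢A⇒B ⊢A)     = evalB-mp allJustified A B (⟦⟧-sound ⊢A⇒B) (⟦⟧-sound ⊢A)
⟦⟧-sound (jv {A} x t ⊢A)          = trans (⟦⟧-subst A x t) (⟦⟧-sound ⊢A)

mainTheorem6 : ¬ (⊢SE ⊥')
mainTheorem6 ⊢⊥ with ⟦⟧-sound ⊢⊥
... | ()
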